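{- Fix an integer $w\ge 0$. Consider lattice walks in $\mathbb{Z}^2$ with steps $(1,1)$, $(1,-1)$, $(2,2)$, $(2,-2)$ that start at $(0,0)$, end on the $x$-axis, and never leave the strip $0\le y\le w$ (the empty walk is included). Give each such walk the weight $z^{L/2}$, where $L$ is the total horizontal distance it travels (equivalently, weight $\sqrt z$ per unit distance along the $x$-axis), and let $F_w(z)$ be the sum of these weights, i.e. $F_w(z)=\sum_{n\ge 0} a_{w,n} z^n$ where $a_{w,n}$ is the number of such walks from $(0,0)$ to $(2n,0)$. Then for every $w\ge 4$, $$F_w = 1 - zF_w + 2zF_wF_{w-1} + 2z^2F_wF_{w-1}F_{w-2} - (z^3+z^4)F_wF_{w-1}F_{w-2}F_{w-3} + z^5F_wF_{w-1}F_{w-2}F_{w-3}F_{w-4}.$$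
   Context: $F_w(z)$ is regarded as a formal power series in $z$ (it is in fact a rational function). Combinatorially, $a_{w,n}$ counts basketball games (with scoring of 1 or 2 points) ending in an $n$:$n$ tie in which the home team never trails and never leads by more than $w$ points. -}

module Defs where

open import Data.Nat using (ℕ; zero; suc; _+_; _∸_; _≤?_; _<?_)
open import Data.Integer using (ℤ; +_) renaming (_+_ to _+ℤ_; _*_ to _*ℤ_; _-_ to _-ℤ_)
open import Relation.Nullary using (yes; no)
open import Relation.Nullary.Decidable using (⌊_⌋)
open import Data.Bool using (Bool; true; false)

-- walks w h m : number of lattice walks with steps (1,1),(1,-1),(2,2),(2,-2)
--   starting at height h, travelling total horizontal distance m,
--   staying in the strip 0 ≤ y ≤ w and ending at height 0.
-- (Heights are natural numbers, so y ≥ 0 is built in; the start height h is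
--  assumed ≤ w where it matters — we only use h = 0.)
-- guard: keep n if the side condition holds, else 0
[_]_ : Bool → ℕ → ℕ
[ true ] n = n
[ false ] n = 0

walks : ℕ → ℕ → ℕ → ℕ
walks w zero zero = 1
walks w (suc h) zero = 0
walks w zero (suc zero) =
  [ ⌊ 1 ≤? w ⌋ ] walks w 1 zero
walks w (suc h) (suc zero) =
  [ ⌊ suc (suc h) ≤? w ⌋ ] walks w (suc (suc h)) zero
  + walks w h zero
walks w zero (suc (suc m)) =
  [ ⌊ 1 ≤? w ⌋ ] walks w 1 (suc m)
  + [ ⌊ 2 ≤? w ⌋ ] walks w 2 m
walks w (suc zero) (suc (suc m)) =
  [ ⌊ 2 ≤? w ⌋ ] walks w 2 (suc m)
  + walks w 0 (suc m)
  + [ ⌊ 3 ≤? w ⌋ ] walks w 3 m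
walks w (suc (suc h)) (suc (suc m)) =
  [ ⌊ suc (suc (suc h)) ≤? w ⌋ ] walks w (suc (suc (suc h))) (suc m)
  + walks w (suc h) (suc m)
  + [ ⌊ suc (suc (suc (suc h))) ≤? w ⌋ ] walks w (suc (suc (suc (suc h)))) m
  + walks w h m

a : ℕ → ℕ → ℕ
a w n = walks w 0 (n + n)

Series : Set
Series = ℕ → ℤ

F : ℕ → Series
F w n = + (a w n)

one : Series
one zero = + 1
one (suc n) = + 0

_⊕_ : Series → Series → Series
(f ⊕ g) n = f n +ℤ g n

_⊝_ : Series → Series → Series
(f ⊝ g) n = f n -ℤ g n

_·_ : ℤ → Series → Series
(c · f) n = c *ℤ f n

z^_·_ : ℕ → Series → Series
(z^ k · f) n with n <? k
... | yes _ = + 0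
... | no _ = f (n ∸ k)

convSum : Series → Series → ℕ → ℕ → ℤ
convSum f g n zero = f 0 *ℤ g n
convSum f g n (suc i) = convSum f g n i +ℤ (f (suc i) *ℤ g (n ∸ suc i))

_⊛_ : Series → Series → Series
(f ⊛ g) n = convSum f g n n

infixl 7 _⊛_
infixr 7 _·_
infixl 6 _⊕_ _⊝_
infixr 8 [_]_

-- Weight a walk by t per unit of horizontal distance, so that z = t², and let aᵢⱼ v be the
-- generating function of walks from height i to height j in the strip 0 ≤ y ≤ v; then F_w is the
-- even part of a₀₀ w. Cutting walks at their first or last visit to height 0 relates the strip
-- of width v + 1 to the strip of width v, seen as the heights 1 … v + 1:
--   a₀₀ (v+1) = 1 + P a₀₀ (v+1),  a₀₁ (v+1) = a₀₀ (v+1) G,  a₁₀ (v+1) = a₀₀ (v+1) E,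
--   a₁₁ (v+1) = a₀₀ v + a₀₁ (v+1) E,
-- where the first-return series P, the first-passage series E and the last-exit series G are
-- polynomials in t and the aᵢⱼ v. Hence a₀₀ a₁₁ − a₀₁ a₁₀ at width v + 1 equals a₀₀ (v+1) a₀₀ v,
-- and expanding P three levels down eliminates everything but a₀₀ w, …, a₀₀ (w − 4). Every
-- decomposition is obtained by showing that both sides solve the same height-indexed linear
-- system.

module Submission where

open import Defs
open import Data.Nat as Nat using (ℕ; zero; suc; _≤_; _<_; _∸_; s≤s; z≤n; parity)
open import Data.Parity.Base using (1ℙ)
import Data.Nat.Properties as ℕₚ
open import Data.Integer as ℤ using (ℤ; +_; -_) renaming (_+_ to _+ℤ_; _*_ to _*ℤ_)
import Data.Integer.Properties as ℤₚ
open import Data.Integer.Solver using (module +-*-Solver)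
open import Data.Bool using (Bool; true; false; if_then_else_)
open import Data.Empty using (⊥-elim)
open import Relation.Nullary.Decidable using (⌊_⌋)
open import Data.Maybe using (Maybe; just; nothing)
open import Data.Product using (_×_; _,_; proj₁)
open import Relation.Nullary using (yes; no)
open import Relation.Binary.PropositionalEquality using (_≡_; refl; sym; trans; cong; cong₂; subst; module ≡-Reasoning)
open import Algebra.Bundles using (CommutativeRing)
open import Algebra.Solver.Ring.AlmostCommutativeRing
  using (fromCommutativeRing; _-Raw-AlmostCommutative⟶_)
import Algebra.Solver.Ring
import Relation.Binary.Reasoning.Setoid

-- Formal power series with integer coefficients

module PowerSeries where

  infix  4 _≈_
  infixl 7 _⊗_

  _≈_ : Series → Series → Set
  f ≈ g = ∀ n → f n ≡ g n

  0ₛ : Series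
  0ₛ n = + 0

  ⊖_ : Series → Series
  (⊖ f) n = - f n

  tail : Series → Series
  tail f n = f (suc n)

  _⊗_ : Series → Series → Series
  (f ⊗ g) zero    = f 0 *ℤ g 0
  (f ⊗ g) (suc n) = f 0 *ℤ g (suc n) +ℤ (tail f ⊗ g) n

  open +-*-Solver

  ⊗-cong : ∀ {f f′ g g′} → f ≈ f′ → g ≈ g′ → f ⊗ g ≈ f′ ⊗ g′
  ⊗-cong f≈f′ g≈g′ zero    = cong₂ _*ℤ_ (f≈f′ 0) (g≈g′ 0)
  ⊗-cong f≈f′ g≈g′ (suc n) =
    cong₂ _+ℤ_ (cong₂ _*ℤ_ (f≈f′ 0) (g≈g′ (suc n))) (⊗-cong (λ k → f≈f′ (suc k)) g≈g′ n)

  ⊗-zeroˡ : ∀ f → 0ₛ ⊗ f ≈ 0ₛ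
  ⊗-zeroˡ f zero    = ℤₚ.*-zeroˡ (f 0)
  ⊗-zeroˡ f (suc n) = cong₂ _+ℤ_ (ℤₚ.*-zeroˡ (f (suc n))) (⊗-zeroˡ f n)

  ⊗-identityˡ : ∀ f → one ⊗ f ≈ f
  ⊗-identityˡ f zero    = ℤₚ.*-identityˡ (f 0)
  ⊗-identityˡ f (suc n) =
    trans (cong₂ _+ℤ_ (ℤₚ.*-identityˡ (f (suc n))) (⊗-zeroˡ f n)) (ℤₚ.+-identityʳ _)

  ⊗-distribʳ : ∀ f g h → (f ⊕ g) ⊗ h ≈ f ⊗ h ⊕ g ⊗ h
  ⊗-distribʳ f g h zero    = ℤₚ.*-distribʳ-+ (h 0) (f 0) (g 0)
  ⊗-distribʳ f g h (suc n)
    rewrite ⊗-distribʳ (tail f) (tail g) h n | ℤₚ.*-distribʳ-+ (h (suc n)) (f 0) (g 0) =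
    solve 4 (λ a b c d → (a :+ b) :+ (c :+ d) := (a :+ c) :+ (b :+ d)) refl
      (f 0 *ℤ h (suc n)) (g 0 *ℤ h (suc n)) ((tail f ⊗ h) n) ((tail g ⊗ h) n)

  ·-⊗-assoc : ∀ c f g → (c · f) ⊗ g ≈ c · (f ⊗ g)
  ·-⊗-assoc c f g zero    = ℤₚ.*-assoc c (f 0) (g 0)
  ·-⊗-assoc c f g (suc n) =
    trans (cong₂ _+ℤ_ (ℤₚ.*-assoc c (f 0) (g (suc n))) (·-⊗-assoc c (tail f) g n))
          (sym (ℤₚ.*-distribˡ-+ c (f 0 *ℤ g (suc n)) _))

  ⊗-comm : ∀ f g → f ⊗ g ≈ g ⊗ f
  ⊗-comm f g zero          = ℤₚ.*-comm (f 0) (g 0)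
  ⊗-comm f g (suc zero)    =
    solve 4 (λ a b c d → a :* b :+ c :* d := d :* c :+ b :* a) refl (f 0) (g 1) (f 1) (g 0)
  ⊗-comm f g (suc (suc n)) = begin
    f 0 *ℤ g (2 + n) +ℤ (tail f ⊗ g) (suc n)
      ≡⟨ cong (f 0 *ℤ g (2 + n) +ℤ_) (⊗-comm (tail f) g (suc n)) ⟩
    f 0 *ℤ g (2 + n) +ℤ (g 0 *ℤ f (2 + n) +ℤ (tail g ⊗ tail f) n)
      ≡⟨ cong (λ x → f 0 *ℤ g (2 + n) +ℤ (g 0 *ℤ f (2 + n) +ℤ x)) (⊗-comm (tail g) (tail f) n) ⟩
    f 0 *ℤ g (2 + n) +ℤ (g 0 *ℤ f (2 + n) +ℤ (tail f ⊗ tail g) n)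
      ≡⟨ solve 3 (λ a b c → a :+ (b :+ c) := b :+ (a :+ c)) refl (f 0 *ℤ g (2 + n)) (g 0 *ℤ f (2 + n)) _ ⟩
    g 0 *ℤ f (2 + n) +ℤ (f 0 *ℤ g (2 + n) +ℤ (tail f ⊗ tail g) n)
      ≡⟨ cong (g 0 *ℤ f (2 + n) +ℤ_) (⊗-comm (tail g) f (suc n)) ⟨
    g 0 *ℤ f (2 + n) +ℤ (tail g ⊗ f) (suc n)
      ∎
    where
    open ≡-Reasoning
    open Nat using (_+_)

  ⊗-assoc : ∀ f g h → (f ⊗ g) ⊗ h ≈ f ⊗ (g ⊗ h)
  ⊗-assoc f g h zero    = ℤₚ.*-assoc (f 0) (g 0) (h 0)
  ⊗-assoc f g h (suc n) = begin
    (f 0 *ℤ g 0) *ℤ h (suc n) +ℤ (tail (f ⊗ g) ⊗ h) n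
      ≡⟨ cong ((f 0 *ℤ g 0) *ℤ h (suc n) +ℤ_)
           (trans (⊗-distribʳ (f 0 · tail g) (tail f ⊗ g) h n)
                  (cong₂ _+ℤ_ (·-⊗-assoc (f 0) (tail g) h n) (⊗-assoc (tail f) g h n))) ⟩
    (f 0 *ℤ g 0) *ℤ h (suc n) +ℤ (f 0 *ℤ (tail g ⊗ h) n +ℤ (tail f ⊗ (g ⊗ h)) n)
      ≡⟨ solve 5 (λ a b c d e → (a :* b) :* c :+ (a :* d :+ e) := a :* (b :* c :+ d) :+ e) refl
           (f 0) (g 0) (h (suc n)) ((tail g ⊗ h) n) ((tail f ⊗ (g ⊗ h)) n) ⟩
    f 0 *ℤ (g 0 *ℤ h (suc n) +ℤ (tail g ⊗ h) n) +ℤ (tail f ⊗ (g ⊗ h)) n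
      ∎
    where open ≡-Reasoning

  ⊗-distribˡ : ∀ f g h → f ⊗ (g ⊕ h) ≈ f ⊗ g ⊕ f ⊗ h
  ⊗-distribˡ f g h n = trans (⊗-comm f (g ⊕ h) n)
    (trans (⊗-distribʳ g h f n) (cong₂ _+ℤ_ (⊗-comm g f n) (⊗-comm h f n)))

  commutativeRing : CommutativeRing _ _
  commutativeRing = record
    { Carrier = Series ; _≈_ = _≈_ ; _+_ = _⊕_ ; _*_ = _⊗_ ; -_ = ⊖_ ; 0# = 0ₛ ; 1# = one
    ; isCommutativeRing = record
      { isRing = record
        { +-isAbelianGroup = record
          { isGroup = record
            { isMonoid = record
              { isSemigroup = record
                { isMagma = record
                  { isEquivalence = record
                    { refl = λ _ → refl ; sym = λ p n → sym (p n) ; trans = λ p q n → trans (p n) (q n) }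
                  ; ∙-cong = λ p q n → cong₂ _+ℤ_ (p n) (q n) }
                ; assoc = λ f g h n → ℤₚ.+-assoc (f n) (g n) (h n) }
              ; identity = (λ f n → ℤₚ.+-identityˡ (f n)) , (λ f n → ℤₚ.+-identityʳ (f n)) }
            ; inverse = (λ f n → ℤₚ.+-inverseˡ (f n)) , (λ f n → ℤₚ.+-inverseʳ (f n))
            ; ⁻¹-cong = λ p n → cong -_ (p n) }
          ; comm = λ f g n → ℤₚ.+-comm (f n) (g n) }
        ; *-cong = ⊗-cong
        ; *-assoc = ⊗-assoc
        ; *-identity = ⊗-identityˡ , (λ f n → trans (⊗-comm f one n) (⊗-identityˡ f n))
        ; distrib = ⊗-distribˡ , (λ f g h → ⊗-distribʳ g h f) }
      ; *-comm = ⊗-comm } }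

  scalar : ℤ → Series
  scalar c zero    = c
  scalar c (suc n) = + 0

  scalar-⊗ : ∀ c f → scalar c ⊗ f ≈ c · f
  scalar-⊗ c f zero    = refl
  scalar-⊗ c f (suc n) = trans (cong (c *ℤ f (suc n) +ℤ_) (⊗-zeroˡ f n)) (ℤₚ.+-identityʳ _)

  -- Agrees with scalar, but makes the solver's constants 0 and 1 definitionally 0ₛ and one.
  constant : ℤ → Series
  constant (+ 0) = 0ₛ
  constant (+ 1) = one
  constant c     = scalar c

  constant≈scalar : ∀ c → constant c ≈ scalar c
  constant≈scalar (+ 0)           zero    = refl
  constant≈scalar (+ 0)           (suc n) = refl
  constant≈scalar (+ 1)           zero    = refl
  constant≈scalar (+ 1)           (suc n) = refl
  constant≈scalar (+ suc (suc k)) n       = refl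
  constant≈scalar ℤ.-[1+ k ]      n       = refl

  constant-homomorphism : ℤ.+-*-rawRing -Raw-AlmostCommutative⟶ fromCommutativeRing commutativeRing
  constant-homomorphism = record
    { ⟦_⟧    = constant
    ; +-homo = λ a b → via (λ { zero → refl ; (suc n) → refl }) λ n → cong₂ _+ℤ_ (c≈s a n) (c≈s b n)
    ; *-homo = λ a b → via (λ n → sym (trans (scalar-⊗ a (scalar b) n) (*-scalar a b n)))
                           (⊗-cong (c≈s a) (c≈s b))
    ; -‿homo = λ a → via (λ { zero → refl ; (suc n) → refl }) λ n → cong -_ (c≈s a n)
    ; 0-homo = λ _ → refl
    ; 1-homo = λ _ → refl }
    where
    c≈s : ∀ c → constant c ≈ scalar c
    c≈s = constant≈scalar
    via : ∀ {c f g} → scalar c ≈ g → f ≈ g → constant c ≈ f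
    via {c} s≈g f≈g n = trans (c≈s c n) (trans (s≈g n) (sym (f≈g n)))
    *-scalar : ∀ a b → a · scalar b ≈ scalar (a *ℤ b)
    *-scalar a b zero    = refl
    *-scalar a b (suc n) = ℤₚ.*-zeroʳ a

  constant-≟ : ∀ a b → Maybe (constant a ≈ constant b)
  constant-≟ a b with a ℤ.≟ b
  ... | yes refl = just (λ _ → refl)
  ... | no _     = nothing

  module Solver = Algebra.Solver.Ring ℤ.+-*-rawRing (fromCommutativeRing commutativeRing)
                    constant-homomorphism constant-≟

open PowerSeries

-- Height-indexed linear systems

Family : Set
Family = ℕ → Series

shift : Series → Series
shift f zero    = + 0
shift f (suc n) = f n

shift-cong : ∀ {f g} → f ≈ g → shift f ≈ shift g
shift-cong f≈g zero    = refl
shift-cong f≈g (suc n) = f≈g n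

below₁ below₂ : Family → ℕ → Series
below₁ Y zero    = 0ₛ
below₁ Y (suc h) = Y h
below₂ Y zero          = 0ₛ
below₂ Y (suc zero)    = 0ₛ
below₂ Y (suc (suc h)) = Y h

step : Family → ℕ → Series
step Y h = shift (below₁ Y h ⊕ Y (suc h)) ⊕ shift (shift (below₂ Y h ⊕ Y (suc (suc h))))

onlyIf : Bool → Series → Series
onlyIf true  f = f
onlyIf false f = 0ₛ

record StripSystem (v : ℕ) (stepAt0 : Bool) (c : Family) (Y : Family) : Set where
  field
    above : ∀ h → v < h → Y h ≈ 0ₛ
    row₀  : Y 0 ≈ c 0 ⊕ onlyIf stepAt0 (step Y 0)
    row   : ∀ h → suc h ≤ v → Y (suc h) ≈ c (suc h) ⊕ step Y (suc h)

-- Coefficient m of a row only involves coefficients m − 1 and m − 2 of the unknowns.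
module _ {v b c Y Y′} (S : StripSystem v b c Y) (S′ : StripSystem v b c Y′) where
  private
    module S  = StripSystem S
    module S′ = StripSystem S′

    AgreeAt : ℕ → Set
    AgreeAt m = ∀ h → Y h m ≡ Y′ h m

    StepsAgreeAt : ℕ → Set
    StepsAgreeAt m = ∀ h → step Y h m ≡ step Y′ h m

    below₁-agree : ∀ {m} → AgreeAt m → ∀ h → below₁ Y h m ≡ below₁ Y′ h m
    below₁-agree eq zero    = refl
    below₁-agree eq (suc h) = eq h

    below₂-agree : ∀ {m} → AgreeAt m → ∀ h → below₂ Y h m ≡ below₂ Y′ h m
    below₂-agree eq zero          = refl
    below₂-agree eq (suc zero)    = refl
    below₂-agree eq (suc (suc h)) = eq h

    steps-agree₀ : StepsAgreeAt 0
    steps-agree₀ h = refl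

    steps-agree₁ : AgreeAt 0 → StepsAgreeAt 1
    steps-agree₁ eq h = cong (_+ℤ + 0) (cong₂ _+ℤ_ (below₁-agree eq h) (eq (suc h)))

    steps-agree₂₊ : ∀ {m} → AgreeAt (suc m) → AgreeAt m → StepsAgreeAt (suc (suc m))
    steps-agree₂₊ eq₁ eq₀ h =
      cong₂ _+ℤ_ (cong₂ _+ℤ_ (below₁-agree eq₁ h) (eq₁ (suc h)))
                 (cong₂ _+ℤ_ (below₂-agree eq₀ h) (eq₀ (suc (suc h))))

    onlyIf-agree : ∀ {m} b → StepsAgreeAt m → onlyIf b (step Y 0) m ≡ onlyIf b (step Y′ 0) m
    onlyIf-agree true  eq = eq 0
    onlyIf-agree false eq = refl

    agree : ∀ m → StepsAgreeAt m → AgreeAt m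
    agree m eq h with v Nat.<? h
    ... | yes v<h = trans (S.above h v<h m) (sym (S′.above h v<h m))
    agree m eq zero | no _ =
      trans (S.row₀ m) (trans (cong (c 0 m +ℤ_) (onlyIf-agree b eq)) (sym (S′.row₀ m)))
    agree m eq (suc h) | no v≮h = let h<v = ℕₚ.≮⇒≥ v≮h in
      trans (S.row h h<v m) (trans (cong (c (suc h) m +ℤ_) (eq (suc h))) (sym (S′.row h h<v m)))

    agree-pair : ∀ m → AgreeAt m × AgreeAt (suc m)
    agree-pair zero    = let eq₀ = agree 0 steps-agree₀ in eq₀ , agree 1 (steps-agree₁ eq₀)
    agree-pair (suc m) = let (eq₀ , eq₁) = agree-pair m in eq₁ , agree (suc (suc m)) (steps-agree₂₊ eq₁ eq₀)

  stripSystem-unique : ∀ h → Y h ≈ Y′ h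
  stripSystem-unique h m = proj₁ (agree-pair m) h

-- Walks in a strip

δ : ℕ → Family
δ s h = if h Nat.≡ᵇ s then one else 0ₛ

inStrip : ℕ → ℕ → ℤ → ℤ
inStrip v h x = if ⌊ h Nat.≤? v ⌋ then x else + 0

inStrip-≤ : ∀ {v h} x → h ≤ v → inStrip v h x ≡ x
inStrip-≤ {v} {h} x h≤v with h Nat.≤? v
... | yes _   = refl
... | no h≰v = ⊥-elim (h≰v h≤v)

inStrip-> : ∀ {v h} x → v < h → inStrip v h x ≡ + 0
inStrip-> {v} {h} x v<h with h Nat.≤? v
... | yes h≤v = ⊥-elim (ℕₚ.<⇒≱ v<h h≤v)
... | no _    = refl

-- Coefficient m of paths v s h counts walks of horizontal length m from height h to height s
-- in the strip 0 ≤ y ≤ v. The clauses unfold δ s h ⊕ step (paths v s) h coefficientwise; the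
-- helpers stand for below₁ and below₂, whose application to paths v s would not pass the
-- termination checker.
mutual
  paths : ℕ → ℕ → Family
  paths v s h zero          = inStrip v h (δ s h 0 +ℤ (+ 0 +ℤ + 0))
  paths v s h (suc zero)    =
    inStrip v h (δ s h 1 +ℤ ((pathsBelow₁ v s h 0 +ℤ paths v s (suc h) 0) +ℤ + 0))
  paths v s h (suc (suc m)) =
    inStrip v h (δ s h (suc (suc m)) +ℤ ((pathsBelow₁ v s h (suc m) +ℤ paths v s (suc h) (suc m))
                                      +ℤ (pathsBelow₂ v s h m +ℤ paths v s (suc (suc h)) m)))

  pathsBelow₁ : ℕ → ℕ → Family
  pathsBelow₁ v s zero    = 0ₛ
  pathsBelow₁ v s (suc h) = paths v s h

  pathsBelow₂ : ℕ → ℕ → Family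
  pathsBelow₂ v s zero          = 0ₛ
  pathsBelow₂ v s (suc zero)    = 0ₛ
  pathsBelow₂ v s (suc (suc h)) = paths v s h

pathsBelow₁-below₁ : ∀ v s h → pathsBelow₁ v s h ≡ below₁ (paths v s) h
pathsBelow₁-below₁ v s zero    = refl
pathsBelow₁-below₁ v s (suc h) = refl

pathsBelow₂-below₂ : ∀ v s h → pathsBelow₂ v s h ≡ below₂ (paths v s) h
pathsBelow₂-below₂ v s zero          = refl
pathsBelow₂-below₂ v s (suc zero)    = refl
pathsBelow₂-below₂ v s (suc (suc h)) = refl

paths-row : ∀ v s h → h ≤ v → paths v s h ≈ δ s h ⊕ step (paths v s) h
paths-row v s h h≤v zero = inStrip-≤ _ h≤v
paths-row v s h h≤v (suc zero)
  rewrite pathsBelow₁-below₁ v s h = inStrip-≤ _ h≤v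
paths-row v s h h≤v (suc (suc m))
  rewrite pathsBelow₁-below₁ v s h | pathsBelow₂-below₂ v s h = inStrip-≤ _ h≤v

paths-above : ∀ v s h → v < h → paths v s h ≈ 0ₛ
paths-above v s h v<h zero          = inStrip-> _ v<h
paths-above v s h v<h (suc zero)    = inStrip-> _ v<h
paths-above v s h v<h (suc (suc m)) = inStrip-> _ v<h

paths-system : ∀ v s → StripSystem v true (δ s) (paths v s)
paths-system v s = record
  { above = paths-above v s
  ; row₀  = paths-row v s 0 z≤n
  ; row   = λ h → paths-row v s (suc h) }

walkCount : ℕ → Family
walkCount w h m = + ([ ⌊ h Nat.≤? w ⌋ ] walks w h m)

walkCount-≤ : ∀ {w h} → h ≤ w → ∀ m → walkCount w h m ≡ + walks w h m
walkCount-≤ {w} {h} h≤w m with h Nat.≤? w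
... | yes _   = refl
... | no h≰w = ⊥-elim (h≰w h≤w)

walkCount-> : ∀ {w h} → w < h → walkCount w h ≈ 0ₛ
walkCount-> {w} {h} w<h m with h Nat.≤? w
... | yes h≤w = ⊥-elim (ℕₚ.<⇒≱ w<h h≤w)
... | no _    = refl

walkCount-row : ∀ w h → h ≤ w → walkCount w h ≈ δ 0 h ⊕ step (walkCount w) h
walkCount-row w h h≤w m = trans (walkCount-≤ h≤w m) (walks-row h m h≤w)
  where
  open +-*-Solver
  Wc : Family
  Wc = walkCount w
  walks-row : ∀ h m → h ≤ w → + walks w h m ≡ (δ 0 h ⊕ step Wc h) m
  walks-row zero zero _ = refl
  walks-row zero (suc zero) _ with 1 Nat.≤? w
  ... | yes _ = refl
  ... | no _  = refl
  walks-row zero (suc (suc m)) _ =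
    solve 2 (λ x y → x :+ y := con (+ 0) :+ ((con (+ 0) :+ x) :+ (con (+ 0) :+ y))) refl
      (Wc 1 (suc m)) (Wc 2 m)
  walks-row (suc h) zero _ = refl
  walks-row (suc zero) (suc zero) _ with 2 Nat.≤? w
  ... | yes _ = refl
  ... | no _  = refl
  walks-row (suc zero) (suc (suc m)) _ =
    trans (solve 3 (λ x y z → x :+ y :+ z := con (+ 0) :+ ((y :+ x) :+ (con (+ 0) :+ z))) refl
             (Wc 2 (suc m)) (+ walks w 0 (suc m)) (Wc 3 m))
          (cong (λ y → + 0 +ℤ ((y +ℤ Wc 2 (suc m)) +ℤ (+ 0 +ℤ Wc 3 m))) (sym (walkCount-≤ z≤n (suc m))))
  walks-row (suc (suc h)) (suc zero) h+2≤w =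
    trans (by-guard (suc (suc (suc h)) Nat.≤? w))
          (cong (λ y → + 0 +ℤ ((y +ℤ Wc (3 + h) 0) +ℤ + 0)) (sym (walkCount-≤ (ℕₚ.<⇒≤ h+2≤w) 0)))
    where
    open Nat using (_+_)
    by-guard : ∀ d → + ([ ⌊ d ⌋ ] walks w (3 + h) 0 + walks w (suc h) 0)
                   ≡ + 0 +ℤ ((+ walks w (suc h) 0 +ℤ + ([ ⌊ d ⌋ ] walks w (3 + h) 0)) +ℤ + 0)
    by-guard (yes _) = refl
    by-guard (no _)  = refl
  walks-row (suc (suc h)) (suc (suc m)) h+2≤w =
    trans (solve 4 (λ x y z u → x :+ y :+ z :+ u := con (+ 0) :+ ((y :+ x) :+ (u :+ z))) refl
             (Wc (3 + h) (suc m)) (+ walks w (suc h) (suc m)) (Wc (4 + h) m) (+ walks w h m))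
          (cong₂ (λ y u → + 0 +ℤ ((y +ℤ Wc (3 + h) (suc m)) +ℤ (u +ℤ Wc (4 + h) m)))
                 (sym (walkCount-≤ (ℕₚ.<⇒≤ h+2≤w) (suc m)))
                 (sym (walkCount-≤ (ℕₚ.≤-trans (ℕₚ.n≤1+n h) (ℕₚ.<⇒≤ h+2≤w)) m)))
    where open Nat using (_+_)

walkCount-system : ∀ w → StripSystem w true (δ 0) (walkCount w)
walkCount-system w = record
  { above = λ h → walkCount->
  ; row₀  = walkCount-row w 0 z≤n
  ; row   = λ h → walkCount-row w (suc h) }

walks≡paths : ∀ w m → + walks w 0 m ≡ paths w 0 0 m
walks≡paths w = stripSystem-unique (walkCount-system w) (paths-system w 0) 0

open CommutativeRing commutativeRing
  using () renaming (setoid to ≈-setoid; refl to ≈-refl; sym to ≈-sym; trans to ≈-trans; +-cong to ⊕-cong;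
                    +-identityˡ to ⊕-identityˡ)
open Solver using (solve; _:=_; _:+_; _:*_; _:-_; :-_; con)
module ≈-Reasoning = Relation.Binary.Reasoning.Setoid ≈-setoid

⊕-congˡ : ∀ f {g g′} → g ≈ g′ → f ⊕ g ≈ f ⊕ g′
⊕-congˡ f = ⊕-cong (≈-refl {f})

⊕-congʳ : ∀ {f f′} g → f ≈ f′ → f ⊕ g ≈ f′ ⊕ g
⊕-congʳ g f≈f′ = ⊕-cong f≈f′ (≈-refl {g})

⊗-congˡ : ∀ f {g g′} → g ≈ g′ → f ⊗ g ≈ f ⊗ g′
⊗-congˡ f = ⊗-cong (≈-refl {f})

⊗-congʳ : ∀ {f f′} g → f ≈ f′ → f ⊗ g ≈ f′ ⊗ g
⊗-congʳ g f≈f′ = ⊗-cong f≈f′ (≈-refl {g})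

⊝-cong : ∀ {f f′ g g′} → f ≈ f′ → g ≈ g′ → f ⊝ g ≈ f′ ⊝ g′
⊝-cong f≈f′ g≈g′ n = cong₂ ℤ._-_ (f≈f′ n) (g≈g′ n)

⊝-congˡ : ∀ f {g g′} → g ≈ g′ → f ⊝ g ≈ f ⊝ g′
⊝-congˡ f = ⊝-cong (≈-refl {f})

≈-modulo : ∀ {X Y U V} c → X ≈ Y ⊕ c ⊗ (U ⊝ V) → U ≈ V → X ≈ Y
≈-modulo {X} {Y} {U} {V} c X≈ U≈V = begin
  X                   ≈⟨ X≈ ⟩
  Y ⊕ c ⊗ (U ⊝ V)     ≈⟨ ⊕-congˡ Y (⊗-congˡ c (⊕-congʳ (⊖ V) U≈V)) ⟩
  Y ⊕ c ⊗ (V ⊝ V)     ≈⟨ solve 3 (λ Y c V → Y :+ c :* (V :- V) := Y) ≈-refl Y c V ⟩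
  Y                   ∎
  where open ≈-Reasoning

-- A is the inverse of one ⊝ P.
⊗-solution : ∀ P A B G → A ≈ one ⊕ P ⊗ A → B ≈ G ⊕ P ⊗ B → B ≈ A ⊗ G
⊗-solution P A B G A≈ B≈ = begin
  B
    ≈⟨ solve 3 (λ P A B → B := B :* ((con (+ 1) :+ P :* A) :- P :* A)) ≈-refl P A B ⟩
  B ⊗ ((one ⊕ P ⊗ A) ⊝ P ⊗ A)
    ≈⟨ ⊗-congˡ B (⊕-congʳ (⊖ (P ⊗ A)) (≈-sym A≈)) ⟩
  B ⊗ (A ⊝ P ⊗ A)
    ≈⟨ solve 3 (λ P A B → B :* (A :- P :* A) := A :* (B :- P :* B)) ≈-refl P A B ⟩
  A ⊗ (B ⊝ P ⊗ B)
    ≈⟨ ⊗-congˡ A (⊕-congʳ (⊖ (P ⊗ B)) B≈) ⟩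
  A ⊗ ((G ⊕ P ⊗ B) ⊝ P ⊗ B)
    ≈⟨ solve 4 (λ P A B G → A :* ((G :+ P :* B) :- P :* B) := A :* G) ≈-refl P A B G ⟩
  A ⊗ G
    ∎
  where open ≈-Reasoning

-- step as a linear operator

t z : Series
t zero          = + 0
t (suc zero)    = + 1
t (suc (suc n)) = + 0
z = t ⊗ t

shift≈t⊗ : ∀ f → shift f ≈ t ⊗ f
shift≈t⊗ f zero    = sym (ℤₚ.*-zeroˡ (f 0))
shift≈t⊗ f (suc n) = sym (begin
  + 0 *ℤ f (suc n) +ℤ (tail t ⊗ f) n ≡⟨ cong (_+ℤ (tail t ⊗ f) n) (ℤₚ.*-zeroˡ (f (suc n))) ⟩
  + 0 +ℤ (tail t ⊗ f) n              ≡⟨ ℤₚ.+-identityˡ _ ⟩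
  (tail t ⊗ f) n                     ≡⟨ ⊗-cong tail-t ≈-refl n ⟩
  (one ⊗ f) n                        ≡⟨ ⊗-identityˡ f n ⟩
  f n                                ∎)
  where
  open ≡-Reasoning
  tail-t : tail t ≈ one
  tail-t zero    = refl
  tail-t (suc n) = refl

shift²≈z⊗ : ∀ f → shift (shift f) ≈ z ⊗ f
shift²≈z⊗ f = ≈-trans (shift≈t⊗ (shift f))
                (≈-trans (⊗-congˡ t (shift≈t⊗ f)) (≈-sym (⊗-assoc t t f)))

step≈ : ∀ Y h → step Y h ≈ t ⊗ (below₁ Y h ⊕ Y (suc h)) ⊕ z ⊗ (below₂ Y h ⊕ Y (suc (suc h)))
step≈ Y h = ⊕-cong (shift≈t⊗ _) (shift²≈z⊗ _)

below₁-cong : ∀ {X Y} → (∀ h → X h ≈ Y h) → ∀ h → below₁ X h ≈ below₁ Y h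
below₁-cong X≈Y zero    = ≈-refl
below₁-cong X≈Y (suc h) = X≈Y h

below₂-cong : ∀ {X Y} → (∀ h → X h ≈ Y h) → ∀ h → below₂ X h ≈ below₂ Y h
below₂-cong X≈Y zero          = ≈-refl
below₂-cong X≈Y (suc zero)    = ≈-refl
below₂-cong X≈Y (suc (suc h)) = X≈Y h

step-cong : ∀ {X Y} → (∀ h → X h ≈ Y h) → ∀ h → step X h ≈ step Y h
step-cong X≈Y h = ⊕-cong (shift-cong (⊕-cong (below₁-cong X≈Y h) (X≈Y (suc h))))
                         (shift-cong (shift-cong (⊕-cong (below₂-cong X≈Y h) (X≈Y (suc (suc h))))))

module _ (X : Family) (b : Series) (Y : Family) where
  private
    Z : Family
    Z h = X h ⊕ b ⊗ Y h

    lin₀ : 0ₛ ≈ 0ₛ ⊕ b ⊗ 0ₛ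
    lin₀ = solve 1 (λ b → con (+ 0) := con (+ 0) :+ b :* con (+ 0)) ≈-refl b

    below₁-linear : ∀ h → below₁ Z h ≈ below₁ X h ⊕ b ⊗ below₁ Y h
    below₁-linear zero    = lin₀
    below₁-linear (suc h) = ≈-refl

    below₂-linear : ∀ h → below₂ Z h ≈ below₂ X h ⊕ b ⊗ below₂ Y h
    below₂-linear zero          = lin₀
    below₂-linear (suc zero)    = lin₀
    below₂-linear (suc (suc h)) = ≈-refl

  step-linear : ∀ h → step Z h ≈ step X h ⊕ b ⊗ step Y h
  step-linear h = begin
    step Z h
      ≈⟨ step≈ Z h ⟩
    t ⊗ (below₁ Z h ⊕ Z (suc h)) ⊕ z ⊗ (below₂ Z h ⊕ Z (suc (suc h)))
      ≈⟨ ⊕-cong (⊗-congˡ t (⊕-congʳ (Z (suc h)) (below₁-linear h)))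
                (⊗-congˡ z (⊕-congʳ (Z (suc (suc h))) (below₂-linear h))) ⟩
    t ⊗ ((below₁ X h ⊕ b ⊗ below₁ Y h) ⊕ Z (suc h)) ⊕ z ⊗ ((below₂ X h ⊕ b ⊗ below₂ Y h) ⊕ Z (suc (suc h)))
      ≈⟨ solve 10 (λ t b x₁ y₁ x₂ y₂ x₁′ y₁′ x₂′ y₂′ →
           t :* ((x₁ :+ b :* y₁) :+ (x₁′ :+ b :* y₁′)) :+ (t :* t) :* ((x₂ :+ b :* y₂) :+ (x₂′ :+ b :* y₂′))
           := (t :* (x₁ :+ x₁′) :+ (t :* t) :* (x₂ :+ x₂′)) :+ b :* (t :* (y₁ :+ y₁′) :+ (t :* t) :* (y₂ :+ y₂′)))
           ≈-refl t b (below₁ X h) (below₁ Y h) (below₂ X h) (below₂ Y h)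
           (X (suc h)) (Y (suc h)) (X (suc (suc h))) (Y (suc (suc h))) ⟩
    (t ⊗ (below₁ X h ⊕ X (suc h)) ⊕ z ⊗ (below₂ X h ⊕ X (suc (suc h))))
      ⊕ b ⊗ (t ⊗ (below₁ Y h ⊕ Y (suc h)) ⊕ z ⊗ (below₂ Y h ⊕ Y (suc (suc h))))
      ≈⟨ ⊕-cong (≈-sym (step≈ X h)) (⊗-congˡ b (≈-sym (step≈ Y h))) ⟩
    step X h ⊕ b ⊗ step Y h
      ∎
    where open ≈-Reasoning

step-below₁ : ∀ Y h → step (below₁ Y) (suc h) ≈ step Y h
step-below₁ Y zero          = ≈-refl
step-below₁ Y (suc zero)    = ≈-refl
step-below₁ Y (suc (suc h)) = ≈-refl

step-δ₀ : ∀ h → step (δ 0) (suc h) ≈ t ⊗ δ 0 h ⊕ z ⊗ δ 1 h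
step-δ₀ h = begin
  step (δ 0) (suc h)
    ≈⟨ step≈ (δ 0) (suc h) ⟩
  t ⊗ (δ 0 h ⊕ 0ₛ) ⊕ z ⊗ (below₂ (δ 0) (suc h) ⊕ 0ₛ)
    ≈⟨ ⊕-congˡ (t ⊗ (δ 0 h ⊕ 0ₛ)) (⊗-congˡ z (⊕-congʳ 0ₛ (below₂-δ₀ h))) ⟩
  t ⊗ (δ 0 h ⊕ 0ₛ) ⊕ z ⊗ (δ 1 h ⊕ 0ₛ)
    ≈⟨ solve 3 (λ t d₀ d₁ → t :* (d₀ :+ con (+ 0)) :+ (t :* t) :* (d₁ :+ con (+ 0))
                            := t :* d₀ :+ (t :* t) :* d₁) ≈-refl t (δ 0 h) (δ 1 h) ⟩
  t ⊗ δ 0 h ⊕ z ⊗ δ 1 h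
    ∎
  where
  open ≈-Reasoning
  below₂-δ₀ : ∀ h → below₂ (δ 0) (suc h) ≈ δ 1 h
  below₂-δ₀ zero    = ≈-refl
  below₂-δ₀ (suc h) = ≈-refl

-- First passage through height 0

-- firstPassage u h: walks in the strip of width suc u from height h that stop at their first
-- visit to 0. Before that they stay in the heights 1 … suc u, a copy of the strip of width u,
-- and they end with a step of length 1 from height 1 or of length 2 from height 2.
firstPassage : ℕ → Family
firstPassage u zero    = one
firstPassage u (suc h) = t ⊗ paths u 0 h ⊕ z ⊗ paths u 1 h

firstPassage-above : ∀ u h → suc u < h → firstPassage u h ≈ 0ₛ
firstPassage-above u (suc h) (s≤s u<h) = begin
  t ⊗ paths u 0 h ⊕ z ⊗ paths u 1 h
    ≈⟨ ⊕-cong (⊗-congˡ t (paths-above u 0 h u<h)) (⊗-congˡ z (paths-above u 1 h u<h)) ⟩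
  t ⊗ 0ₛ ⊕ z ⊗ 0ₛ
    ≈⟨ solve 1 (λ t → t :* con (+ 0) :+ (t :* t) :* con (+ 0) := con (+ 0)) ≈-refl t ⟩
  0ₛ
    ∎
  where open ≈-Reasoning

-- firstPassage u is δ 0 plus t and z times shifted solutions of the width-u systems, whose
-- sources δ 0 and δ 1 are exactly what step produces from δ 0.
firstPassage-row : ∀ u h → h ≤ u → firstPassage u (suc h) ≈ step (firstPassage u) (suc h)
firstPassage-row u h h≤u = ≈-sym (begin
  step (firstPassage u) (suc h)
    ≈⟨ step-cong firstPassage≈W (suc h) ⟩
  step W (suc h)
    ≈⟨ step-linear X z (below₁ N₁) (suc h) ⟩
  step X (suc h) ⊕ z ⊗ step (below₁ N₁) (suc h)
    ≈⟨ ⊕-cong (step-linear (δ 0) t (below₁ N₀) (suc h)) (⊗-congˡ z (step-below₁ N₁ h)) ⟩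
  (step (δ 0) (suc h) ⊕ t ⊗ step (below₁ N₀) (suc h)) ⊕ z ⊗ step N₁ h
    ≈⟨ ⊕-congʳ (z ⊗ step N₁ h) (⊕-cong (step-δ₀ h) (⊗-congˡ t (step-below₁ N₀ h))) ⟩
  ((t ⊗ δ 0 h ⊕ z ⊗ δ 1 h) ⊕ t ⊗ step N₀ h) ⊕ z ⊗ step N₁ h
    ≈⟨ solve 5 (λ t d₀ d₁ s₀ s₁ → ((t :* d₀ :+ (t :* t) :* d₁) :+ t :* s₀) :+ (t :* t) :* s₁
                                   := t :* (d₀ :+ s₀) :+ (t :* t) :* (d₁ :+ s₁))
         ≈-refl t (δ 0 h) (δ 1 h) (step N₀ h) (step N₁ h) ⟩
  t ⊗ (δ 0 h ⊕ step N₀ h) ⊕ z ⊗ (δ 1 h ⊕ step N₁ h)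
    ≈⟨ ≈-sym (⊕-cong (⊗-congˡ t (paths-row u 0 h h≤u)) (⊗-congˡ z (paths-row u 1 h h≤u))) ⟩
  t ⊗ N₀ h ⊕ z ⊗ N₁ h
    ∎)
  where
  open ≈-Reasoning
  N₀ N₁ X W : Family
  N₀ = paths u 0
  N₁ = paths u 1
  X h = δ 0 h ⊕ t ⊗ below₁ N₀ h
  W h = X h ⊕ z ⊗ below₁ N₁ h

  firstPassage≈W : ∀ h → firstPassage u h ≈ W h
  firstPassage≈W zero    =
    solve 1 (λ t → con (+ 1) := (con (+ 1) :+ t :* con (+ 0)) :+ (t :* t) :* con (+ 0)) ≈-refl t
  firstPassage≈W (suc h) =
    solve 3 (λ t n₀ n₁ → t :* n₀ :+ (t :* t) :* n₁ := (con (+ 0) :+ t :* n₀) :+ (t :* t) :* n₁)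
      ≈-refl t (N₀ h) (N₁ h)

-- Cut a walk at its first visit to 0; M counts the walks that never visit 0.
module _ (u s : ℕ) (M : Family)
         (M₀      : M 0 ≈ 0ₛ)
         (M-row   : ∀ h → h ≤ u → M (suc h) ≈ δ s (suc h) ⊕ step M (suc h))
         (M-above : ∀ h → suc u < h → M h ≈ 0ₛ) where
  private
    b : Series
    b = paths (suc u) s 0

    c : Family
    c zero    = b
    c (suc h) = δ s (suc h)

    Y : Family
    Y h = M h ⊕ b ⊗ firstPassage u h

    Y-system : StripSystem (suc u) false c Y
    Y-system = record
      { above = λ h u<h → ≈-trans (⊕-cong (M-above h u<h) (⊗-congˡ b (firstPassage-above u h u<h)))
                                  (solve 1 (λ b → con (+ 0) :+ b :* con (+ 0) := con (+ 0)) ≈-refl b)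
      ; row₀  = ≈-trans (⊕-congʳ (b ⊗ one) M₀)
                        (solve 1 (λ b → con (+ 0) :+ b :* con (+ 1) := b :+ con (+ 0)) ≈-refl b)
      ; row   = λ h h<u → let h≤u = ℕₚ.≤-pred h<u in ≈-trans
          (⊕-cong (M-row h h≤u) (⊗-congˡ b (firstPassage-row u h h≤u)))
          (≈-trans (solve 4 (λ d m b f → (d :+ m) :+ b :* f := d :+ (m :+ b :* f)) ≈-refl
                      (δ s (suc h)) (step M (suc h)) b (step (firstPassage u) (suc h)))
                   (⊕-congˡ (δ s (suc h)) (≈-sym (step-linear M b (firstPassage u) (suc h))))) }

    paths-system′ : StripSystem (suc u) false c (paths (suc u) s)
    paths-system′ = record
      { above = paths-above (suc u) s
      ; row₀  = solve 1 (λ b → b := b :+ con (+ 0)) ≈-refl b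
      ; row   = λ h → paths-row (suc u) s (suc h) }

  paths-firstPassage : ∀ h → paths (suc u) s h ≈ M h ⊕ paths (suc u) s 0 ⊗ firstPassage u h
  paths-firstPassage = stripSystem-unique paths-system′ Y-system

step-zero : ∀ h → step (λ _ → 0ₛ) h ≈ 0ₛ
step-zero zero          = λ { zero → refl ; (suc zero) → refl ; (suc (suc n)) → refl }
step-zero (suc zero)    = λ { zero → refl ; (suc zero) → refl ; (suc (suc n)) → refl }
step-zero (suc (suc h)) = λ { zero → refl ; (suc zero) → refl ; (suc (suc n)) → refl }

paths₀-firstPassage : ∀ u h → paths (suc u) 0 h ≈ 0ₛ ⊕ paths (suc u) 0 0 ⊗ firstPassage u h
paths₀-firstPassage u = paths-firstPassage u 0 (λ _ → 0ₛ) ≈-refl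
  (λ h _ → ≈-sym (⊕-congˡ 0ₛ (step-zero (suc h)))) (λ _ _ → ≈-refl)

paths₁-firstPassage : ∀ u h → paths (suc u) 1 h ≈ below₁ (paths u 0) h ⊕ paths (suc u) 1 0 ⊗ firstPassage u h
paths₁-firstPassage u = paths-firstPassage u 1 (below₁ (paths u 0)) ≈-refl
  (λ h h≤u → ≈-trans (paths-row u 0 h h≤u) (⊕-congˡ (δ 0 h) (≈-sym (step-below₁ (paths u 0) h))))
  (λ { (suc h) (s≤s u<h) → paths-above u 0 h u<h })

-- The recurrence between consecutive widths

a₀₀ a₀₁ a₁₀ a₁₁ : ℕ → Series
a₀₀ v = paths v 0 0
a₀₁ v = paths v 1 0
a₁₀ v = paths v 0 1
a₁₁ v = paths v 1 1

-- Walks from 0 stopped at their first return to 0, and walks from 0 to 1 after their last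
-- visit to 0.
firstReturn lastExit : ℕ → Series
firstReturn u = t ⊗ firstPassage u 1 ⊕ z ⊗ firstPassage u 2
lastExit    u = t ⊗ a₀₀ u ⊕ z ⊗ a₁₀ u

a₁₀-firstPassage : ∀ u → a₁₀ (suc u) ≈ a₀₀ (suc u) ⊗ firstPassage u 1
a₁₀-firstPassage u = ≈-trans (paths₀-firstPassage u 1) (⊕-identityˡ _)

a₁₁-firstPassage : ∀ u → a₁₁ (suc u) ≈ a₀₀ u ⊕ a₀₁ (suc u) ⊗ firstPassage u 1
a₁₁-firstPassage u = paths₁-firstPassage u 1

a₀₀-firstReturn : ∀ u → a₀₀ (suc u) ≈ one ⊕ firstReturn u ⊗ a₀₀ (suc u)
a₀₀-firstReturn u = begin
  a₀₀ (suc u)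
    ≈⟨ paths-row (suc u) 0 0 z≤n ⟩
  one ⊕ step (paths (suc u) 0) 0
    ≈⟨ ⊕-congˡ one (step≈ (paths (suc u) 0) 0) ⟩
  one ⊕ (t ⊗ (0ₛ ⊕ a₁₀ (suc u)) ⊕ z ⊗ (0ₛ ⊕ paths (suc u) 0 2))
    ≈⟨ ⊕-congˡ one (⊕-cong (⊗-congˡ t (⊕-congˡ 0ₛ (paths₀-firstPassage u 1)))
                           (⊗-congˡ z (⊕-congˡ 0ₛ (paths₀-firstPassage u 2)))) ⟩
  one ⊕ (t ⊗ (0ₛ ⊕ (0ₛ ⊕ A ⊗ firstPassage u 1)) ⊕ z ⊗ (0ₛ ⊕ (0ₛ ⊕ A ⊗ firstPassage u 2)))
    ≈⟨ solve 4 (λ t A e φ → let o = con (+ 0) in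
                  con (+ 1) :+ (t :* (o :+ (o :+ A :* e)) :+ (t :* t) :* (o :+ (o :+ A :* φ)))
                  := con (+ 1) :+ (t :* e :+ (t :* t) :* φ) :* A)
         ≈-refl t A (firstPassage u 1) (firstPassage u 2) ⟩
  one ⊕ firstReturn u ⊗ A
    ∎
  where
  open ≈-Reasoning
  A : Series
  A = a₀₀ (suc u)

a₀₁-lastExit-firstReturn : ∀ u → a₀₁ (suc u) ≈ lastExit u ⊕ firstReturn u ⊗ a₀₁ (suc u)
a₀₁-lastExit-firstReturn u = begin
  a₀₁ (suc u)
    ≈⟨ paths-row (suc u) 1 0 z≤n ⟩
  0ₛ ⊕ step (paths (suc u) 1) 0
    ≈⟨ ⊕-congˡ 0ₛ (step≈ (paths (suc u) 1) 0) ⟩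
  0ₛ ⊕ (t ⊗ (0ₛ ⊕ a₁₁ (suc u)) ⊕ z ⊗ (0ₛ ⊕ paths (suc u) 1 2))
    ≈⟨ ⊕-congˡ 0ₛ (⊕-cong (⊗-congˡ t (⊕-congˡ 0ₛ (paths₁-firstPassage u 1)))
                          (⊗-congˡ z (⊕-congˡ 0ₛ (paths₁-firstPassage u 2)))) ⟩
  0ₛ ⊕ (t ⊗ (0ₛ ⊕ (a₀₀ u ⊕ B ⊗ firstPassage u 1)) ⊕ z ⊗ (0ₛ ⊕ (a₁₀ u ⊕ B ⊗ firstPassage u 2)))
    ≈⟨ solve 6 (λ t B a q e φ → let o = con (+ 0) in
                  o :+ (t :* (o :+ (a :+ B :* e)) :+ (t :* t) :* (o :+ (q :+ B :* φ)))
                  := (t :* a :+ (t :* t) :* q) :+ (t :* e :+ (t :* t) :* φ) :* B)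
         ≈-refl t B (a₀₀ u) (a₁₀ u) (firstPassage u 1) (firstPassage u 2) ⟩
  lastExit u ⊕ firstReturn u ⊗ B
    ∎
  where
  open ≈-Reasoning
  B : Series
  B = a₀₁ (suc u)

a₀₁-lastExit : ∀ u → a₀₁ (suc u) ≈ a₀₀ (suc u) ⊗ lastExit u
a₀₁-lastExit u = ⊗-solution (firstReturn u) (a₀₀ (suc u)) (a₀₁ (suc u)) (lastExit u)
  (a₀₀-firstReturn u) (a₀₁-lastExit-firstReturn u)

z^_⊗_ : ℕ → Series → Series
z^ zero  ⊗ f = f
z^ suc k ⊗ f = z ⊗ (z^ k ⊗ f)

det K : ℕ → Series
det v = a₀₀ v ⊗ a₁₁ v ⊝ a₀₁ v ⊗ a₁₀ v
K   v = a₁₁ v ⊕ z ⊗ det v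

det-suc : ∀ y → det (suc y) ≈ a₀₀ (suc y) ⊗ a₀₀ y
det-suc y = begin
  A ⊗ a₁₁ (suc y) ⊝ a₀₁ (suc y) ⊗ a₁₀ (suc y)
    ≈⟨ ⊝-cong (⊗-congˡ A (a₁₁-firstPassage y)) (⊗-congˡ (a₀₁ (suc y)) (a₁₀-firstPassage y)) ⟩
  A ⊗ (a₀₀ y ⊕ a₀₁ (suc y) ⊗ e) ⊝ a₀₁ (suc y) ⊗ (A ⊗ e)
    ≈⟨ solve 4 (λ A b p e → A :* (b :+ p :* e) :- p :* (A :* e) := A :* b) ≈-refl A (a₀₀ y) (a₀₁ (suc y)) e ⟩
  A ⊗ a₀₀ y
    ∎
  where
  open ≈-Reasoning
  A e : Series
  A = a₀₀ (suc y)
  e = firstPassage y 1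

a₁₁-lastExit : ∀ y → a₁₁ (suc y) ≈ a₀₀ y ⊕ (a₀₀ (suc y) ⊗ lastExit y) ⊗ firstPassage y 1
a₁₁-lastExit y = ≈-trans (a₁₁-firstPassage y)
  (⊕-congˡ (a₀₀ y) (⊗-congʳ (firstPassage y 1) (a₀₁-lastExit y)))

K-suc : ∀ y → K (suc y) ≈ (one ⊕ z) ⊗ (a₀₀ (suc y) ⊗ a₀₀ y) ⊝ z^ 2 ⊗ (a₀₀ (suc y) ⊗ det y)
K-suc y = ≈-modulo (a₀₀ y) (begin
  R ⊕ z ⊗ (A ⊗ R ⊝ a₀₁ (suc y) ⊗ a₁₀ (suc y))
    ≈⟨ ⊕-cong (a₁₁-lastExit y) (⊗-congˡ z (⊝-cong (⊗-congˡ A (a₁₁-lastExit y))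
                                                  (⊗-cong (a₀₁-lastExit y) (a₁₀-firstPassage y)))) ⟩
  R′ ⊕ z ⊗ (A ⊗ R′ ⊝ (A ⊗ lastExit y) ⊗ (A ⊗ firstPassage y 1))
    ≈⟨ solve 6 (λ t A b p q r →
         let z = t :* t ; e = t :* b :+ z :* p ; g = t :* b :+ z :* q
             P = t :* e :+ z :* (t :* q :+ z :* r) ; R′ = b :+ (A :* g) :* e in
         R′ :+ z :* (A :* R′ :- (A :* g) :* (A :* e))
         := ((con (+ 1) :+ z) :* (A :* b) :- z :* (z :* (A :* (b :* r :- p :* q))))
            :+ b :* ((con (+ 1) :+ P :* A) :- A))
         ≈-refl t A (a₀₀ y) (a₀₁ y) (a₁₀ y) (a₁₁ y) ⟩
  ((one ⊕ z) ⊗ (A ⊗ a₀₀ y) ⊝ z^ 2 ⊗ (A ⊗ det y)) ⊕ a₀₀ y ⊗ ((one ⊕ firstReturn y ⊗ A) ⊝ A)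
    ∎) (≈-sym (a₀₀-firstReturn y))
  where
  open ≈-Reasoning
  A R R′ : Series
  A = a₀₀ (suc y)
  R = a₁₁ (suc y)
  R′ = a₀₀ y ⊕ (A ⊗ lastExit y) ⊗ firstPassage y 1

firstReturn-suc : ∀ y → firstReturn (suc y) ≈
  ⊖ z ⊕ constant (+ 2) ⊗ (z ⊗ a₀₀ (suc y)) ⊕ constant (+ 2) ⊗ (z^ 2 ⊗ (a₀₀ (suc y) ⊗ a₀₀ y))
      ⊝ z^ 3 ⊗ (a₀₀ (suc y) ⊗ K y)
firstReturn-suc y = ≈-modulo (z ⊗ (one ⊕ z ⊗ a₀₀ y)) (begin
  t ⊗ (t ⊗ A ⊕ z ⊗ a₀₁ (suc y)) ⊕ z ⊗ (t ⊗ a₁₀ (suc y) ⊕ z ⊗ a₁₁ (suc y))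
    ≈⟨ ⊕-cong (⊗-congˡ t (⊕-congˡ (t ⊗ A) (⊗-congˡ z (a₀₁-lastExit y))))
              (⊗-congˡ z (⊕-cong (⊗-congˡ t (a₁₀-firstPassage y)) (⊗-congˡ z (a₁₁-lastExit y)))) ⟩
  t ⊗ (t ⊗ A ⊕ z ⊗ (A ⊗ lastExit y)) ⊕ z ⊗ (t ⊗ (A ⊗ firstPassage y 1) ⊕ z ⊗ R′)
    ≈⟨ solve 6 (λ t A b p q r →
         let z = t :* t ; e = t :* b :+ z :* p ; g = t :* b :+ z :* q
             P = t :* e :+ z :* (t :* q :+ z :* r) ; R′ = b :+ (A :* g) :* e in
         t :* (t :* A :+ z :* (A :* g)) :+ z :* (t :* (A :* e) :+ z :* R′)
         := (:- z :+ con (+ 2) :* (z :* A) :+ con (+ 2) :* (z :* (z :* (A :* b)))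
              :- z :* (z :* (z :* (A :* (r :+ z :* (b :* r :- p :* q))))))
            :+ (z :* (con (+ 1) :+ z :* b)) :* ((con (+ 1) :+ P :* A) :- A))
         ≈-refl t A (a₀₀ y) (a₀₁ y) (a₁₀ y) (a₁₁ y) ⟩
  (⊖ z ⊕ constant (+ 2) ⊗ (z ⊗ A) ⊕ constant (+ 2) ⊗ (z^ 2 ⊗ (A ⊗ a₀₀ y)) ⊝ z^ 3 ⊗ (A ⊗ K y))
    ⊕ (z ⊗ (one ⊕ z ⊗ a₀₀ y)) ⊗ ((one ⊕ firstReturn y ⊗ A) ⊝ A)
    ∎) (≈-sym (a₀₀-firstReturn y))
  where
  open ≈-Reasoning
  A R′ : Series
  A = a₀₀ (suc y)
  R′ = a₀₀ y ⊕ (A ⊗ lastExit y) ⊗ firstPassage y 1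

a₀₀-identity : (w : ℕ) → 4 ≤ w →
  a₀₀ w ≈
    (one
      ⊝ (z^ 1 ⊗ a₀₀ w)
      ⊕ (constant (+ 2) ⊗ (z^ 1 ⊗ (a₀₀ w ⊗ a₀₀ (w ∸ 1))))
      ⊕ (constant (+ 2) ⊗ (z^ 2 ⊗ (a₀₀ w ⊗ a₀₀ (w ∸ 1) ⊗ a₀₀ (w ∸ 2))))
      ⊝ ((z^ 3 ⊗ (a₀₀ w ⊗ a₀₀ (w ∸ 1) ⊗ a₀₀ (w ∸ 2) ⊗ a₀₀ (w ∸ 3)))
         ⊕ (z^ 4 ⊗ (a₀₀ w ⊗ a₀₀ (w ∸ 1) ⊗ a₀₀ (w ∸ 2) ⊗ a₀₀ (w ∸ 3))))
      ⊕ (z^ 5 ⊗ (a₀₀ w ⊗ a₀₀ (w ∸ 1) ⊗ a₀₀ (w ∸ 2) ⊗ a₀₀ (w ∸ 3) ⊗ a₀₀ (w ∸ 4))))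
a₀₀-identity (suc (suc (suc (suc c)))) (s≤s (s≤s (s≤s (s≤s _)))) = begin
  A₀
    ≈⟨ a₀₀-firstReturn (3 + c) ⟩
  one ⊕ firstReturn (3 + c) ⊗ A₀
    ≈⟨ ⊕-congˡ one (⊗-congʳ A₀ (firstReturn-suc (2 + c))) ⟩
  one ⊕ (P′ ⊝ z^ 3 ⊗ (A₁ ⊗ K (2 + c))) ⊗ A₀
    ≈⟨ ⊕-congˡ one (⊗-congʳ A₀ (⊝-congˡ P′ (⊗-congˡ z (⊗-congˡ z (⊗-congˡ z (⊗-congˡ A₁ K-closed)))))) ⟩
  one ⊕ (P′ ⊝ z^ 3 ⊗ (A₁ ⊗ ((one ⊕ z) ⊗ (A₂ ⊗ A₃) ⊝ z^ 2 ⊗ (A₂ ⊗ (A₃ ⊗ A₄))))) ⊗ A₀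
    ≈⟨ solve 6 (λ t A₀ A₁ A₂ A₃ A₄ →
         let z = t :* t ; two = con (+ 2) ; one = con (+ 1)
             P′ = :- z :+ two :* (z :* A₁) :+ two :* (z :* (z :* (A₁ :* A₂))) in
         one :+ (P′ :- z :* (z :* (z :* (A₁ :* ((one :+ z) :* (A₂ :* A₃) :- z :* (z :* (A₂ :* (A₃ :* A₄))))))))
                  :* A₀
         := one :- z :* A₀ :+ two :* (z :* (A₀ :* A₁)) :+ two :* (z :* (z :* (A₀ :* A₁ :* A₂)))
            :- (z :* (z :* (z :* (A₀ :* A₁ :* A₂ :* A₃))) :+ z :* (z :* (z :* (z :* (A₀ :* A₁ :* A₂ :* A₃)))))
            :+ z :* (z :* (z :* (z :* (z :* (A₀ :* A₁ :* A₂ :* A₃ :* A₄))))))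
         ≈-refl t A₀ A₁ A₂ A₃ A₄ ⟩
  _ ∎
  where
  open ≈-Reasoning
  open Nat using (_+_)
  A₀ A₁ A₂ A₃ A₄ P′ : Series
  A₀ = a₀₀ (4 + c)
  A₁ = a₀₀ (3 + c)
  A₂ = a₀₀ (2 + c)
  A₃ = a₀₀ (1 + c)
  A₄ = a₀₀ c
  P′ = ⊖ z ⊕ constant (+ 2) ⊗ (z ⊗ A₁) ⊕ constant (+ 2) ⊗ (z^ 2 ⊗ (A₁ ⊗ A₂))

  K-closed : K (2 + c) ≈ (one ⊕ z) ⊗ (A₂ ⊗ A₃) ⊝ z^ 2 ⊗ (A₂ ⊗ (A₃ ⊗ A₄))
  K-closed = ≈-trans (K-suc (1 + c))
    (⊝-congˡ ((one ⊕ z) ⊗ (A₂ ⊗ A₃)) (⊗-congˡ z (⊗-congˡ z (⊗-congˡ A₂ (det-suc c)))))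

-- Odd coefficients vanish

record OddAt (h m : ℕ) : Set where
  constructor oddAt
  field parity≡1 : parity (h Nat.+ m) ≡ 1ℙ

OddAt-pred : ∀ {h m} → OddAt (suc h) (suc m) → OddAt h m
OddAt-pred {h} {m} (oddAt odd) = oddAt (subst (λ k → parity (suc k) ≡ 1ℙ) (ℕₚ.+-suc h m) odd)

OddAt-raise : ∀ {h m} → OddAt h (suc m) → OddAt (suc h) m
OddAt-raise {h} {m} (oddAt odd) = oddAt (subst (λ k → parity k ≡ 1ℙ) (ℕₚ.+-suc h m) odd)

VanishesOddAt : Family → ℕ → Set
VanishesOddAt Y m = ∀ h → OddAt h m → Y h m ≡ + 0

module _ {Y : Family} where
  private
    below₁-vanishesOdd : ∀ {m} → VanishesOddAt Y m → ∀ h → OddAt h (suc m) → below₁ Y h m ≡ + 0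
    below₁-vanishesOdd van zero    odd = refl
    below₁-vanishesOdd van (suc h) odd = van h (OddAt-pred odd)

    below₂-vanishesOdd : ∀ {m} → VanishesOddAt Y m → ∀ h → OddAt h (suc (suc m)) → below₂ Y h m ≡ + 0
    below₂-vanishesOdd van zero          odd = refl
    below₂-vanishesOdd van (suc zero)    odd = refl
    below₂-vanishesOdd van (suc (suc h)) odd = van h (OddAt-pred (OddAt-pred odd))

  step-vanishesOdd₁ : VanishesOddAt Y 0 → VanishesOddAt (step Y) 1
  step-vanishesOdd₁ van₀ h odd =
    cong (_+ℤ + 0) (cong₂ _+ℤ_ (below₁-vanishesOdd van₀ h odd) (van₀ (suc h) (OddAt-raise odd)))

  step-vanishesOdd₂₊ : ∀ {m} → VanishesOddAt Y (suc m) → VanishesOddAt Y m →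
                       VanishesOddAt (step Y) (suc (suc m))
  step-vanishesOdd₂₊ van₁ van₀ h odd =
    cong₂ _+ℤ_ (cong₂ _+ℤ_ (below₁-vanishesOdd van₁ h odd) (van₁ (suc h) (OddAt-raise odd)))
               (cong₂ _+ℤ_ (below₂-vanishesOdd van₀ h odd) (van₀ (suc (suc h)) (OddAt-raise (OddAt-raise odd))))

-- Every step changes the height and the length by amounts of the same parity.
module _ {v b c Y} (S : StripSystem v b c Y) (c-vanishesOdd : ∀ m → VanishesOddAt c m) where
  private
    module S = StripSystem S

    vanishesOdd : ∀ m → VanishesOddAt (step Y) m → VanishesOddAt Y m
    vanishesOdd m step-van h odd with v Nat.<? h
    ... | yes v<h = S.above h v<h m
    vanishesOdd m step-van zero odd | no _ =
      trans (S.row₀ m) (cong₂ _+ℤ_ (c-vanishesOdd m 0 odd) (onlyIf-vanishes b))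
      where
      onlyIf-vanishes : ∀ b → onlyIf b (step Y 0) m ≡ + 0
      onlyIf-vanishes true  = step-van 0 odd
      onlyIf-vanishes false = refl
    vanishesOdd m step-van (suc h) odd | no v≮h =
      trans (S.row h (ℕₚ.≮⇒≥ v≮h) m) (cong₂ _+ℤ_ (c-vanishesOdd m (suc h) odd) (step-van (suc h) odd))

    vanishesOdd-pair : ∀ m → VanishesOddAt Y m × VanishesOddAt Y (suc m)
    vanishesOdd-pair zero    = let van₀ = vanishesOdd 0 (λ _ _ → refl) in
      van₀ , vanishesOdd 1 (step-vanishesOdd₁ van₀)
    vanishesOdd-pair (suc m) = let (van₀ , van₁) = vanishesOdd-pair m in
      van₁ , vanishesOdd (suc (suc m)) (step-vanishesOdd₂₊ van₁ van₀)

  stripSystem-vanishesOdd : ∀ m → VanishesOddAt Y m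
  stripSystem-vanishesOdd m = proj₁ (vanishesOdd-pair m)

δ₀-vanishesOdd : ∀ m → VanishesOddAt (δ 0) m
δ₀-vanishesOdd zero    zero    (oddAt ())
δ₀-vanishesOdd (suc m) zero    odd = refl
δ₀-vanishesOdd m       (suc h) odd = refl

parity-odd : ∀ n → parity (suc (n Nat.+ n)) ≡ 1ℙ
parity-odd zero    = refl
parity-odd (suc n) = subst (λ k → parity k ≡ 1ℙ) (sym (ℕₚ.+-suc n n)) (parity-odd n)

OddFree : Series → Set
OddFree f = ∀ n → f (suc (n Nat.+ n)) ≡ + 0

a₀₀-oddFree : ∀ v → OddFree (a₀₀ v)
a₀₀-oddFree v n =
  stripSystem-vanishesOdd (paths-system v 0) δ₀-vanishesOdd (suc (n Nat.+ n)) 0 (oddAt (parity-odd n))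

-- From t back to z

evenPart : Series → Series
evenPart f n = f (n Nat.+ n)

⊛≈⊗ : ∀ f g → f ⊛ g ≈ f ⊗ g
⊛≈⊗ f g zero    = refl
⊛≈⊗ f g (suc n) = trans (convSum-suc f g n n) (cong (f 0 *ℤ g (suc n) +ℤ_) (⊛≈⊗ (tail f) g n))
  where
  convSum-suc : ∀ f g n i → convSum f g (suc n) (suc i) ≡ f 0 *ℤ g (suc n) +ℤ convSum (tail f) g n i
  convSum-suc f g n zero    = refl
  convSum-suc f g n (suc i) =
    trans (cong (_+ℤ f (suc (suc i)) *ℤ g (n ∸ suc i)) (convSum-suc f g n i))
          (ℤₚ.+-assoc (f 0 *ℤ g (suc n)) (convSum (tail f) g n i) (f (suc (suc i)) *ℤ g (n ∸ suc i)))

evenPart-⊗ : ∀ f g → OddFree g → evenPart (f ⊗ g) ≈ evenPart f ⊗ evenPart g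
evenPart-⊗ f g g-odd n = begin
  (f ⊗ g) (n Nat.+ n)               ≡⟨ ⊗-comm f g (n Nat.+ n) ⟩
  (g ⊗ f) (n Nat.+ n)               ≡⟨ evenPart-⊗ˡ g f g-odd n ⟩
  (evenPart g ⊗ evenPart f) n       ≡⟨ ⊗-comm (evenPart g) (evenPart f) n ⟩
  (evenPart f ⊗ evenPart g) n       ∎
  where
  open ≡-Reasoning
  evenPart-⊗ˡ : ∀ f g → OddFree f → evenPart (f ⊗ g) ≈ evenPart f ⊗ evenPart g
  evenPart-⊗ˡ f g f-odd zero    = refl
  evenPart-⊗ˡ f g f-odd (suc n) rewrite ℕₚ.+-suc n n =
    cong (f 0 *ℤ g (suc (suc (n Nat.+ n))) +ℤ_) (begin
      f 1 *ℤ g (suc (n Nat.+ n)) +ℤ (tail (tail f) ⊗ g) (n Nat.+ n)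
        ≡⟨ cong (λ x → x *ℤ g (suc (n Nat.+ n)) +ℤ rest) (f-odd 0) ⟩
      + 0 *ℤ g (suc (n Nat.+ n)) +ℤ (tail (tail f) ⊗ g) (n Nat.+ n)
        ≡⟨ cong (_+ℤ rest) (ℤₚ.*-zeroˡ (g (suc (n Nat.+ n)))) ⟩
      + 0 +ℤ (tail (tail f) ⊗ g) (n Nat.+ n)
        ≡⟨ ℤₚ.+-identityˡ _ ⟩
      evenPart (tail (tail f) ⊗ g) n
        ≡⟨ evenPart-⊗ˡ (tail (tail f)) g tail²-odd n ⟩
      (evenPart (tail (tail f)) ⊗ evenPart g) n
        ≡⟨ ⊗-congʳ (evenPart g) tail²≈tail n ⟩
      (tail (evenPart f) ⊗ evenPart g) n
        ∎)
    where
    rest : ℤ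
    rest = (tail (tail f) ⊗ g) (n Nat.+ n)

    tail²≈tail : evenPart (tail (tail f)) ≈ tail (evenPart f)
    tail²≈tail k = cong (λ i → f (suc i)) (sym (ℕₚ.+-suc k k))

    tail²-odd : ∀ k → f (suc (suc (suc (k Nat.+ k)))) ≡ + 0
    tail²-odd k = trans (cong (λ i → f (suc (suc i))) (sym (ℕₚ.+-suc k k))) (f-odd (suc k))

F≈evenPart : ∀ w → F w ≈ evenPart (a₀₀ w)
F≈evenPart w n = walks≡paths w (n Nat.+ n)

one≈evenPart : one ≈ evenPart one
one≈evenPart zero    = refl
one≈evenPart (suc n) = refl

⊛-evenPart : ∀ {G H f g} → G ≈ evenPart f → H ≈ evenPart g → OddFree g → G ⊛ H ≈ evenPart (f ⊗ g)
⊛-evenPart {G} {H} {f} {g} G≈ H≈ g-odd n =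
  trans (⊛≈⊗ G H n) (trans (⊗-cong G≈ H≈ n) (sym (evenPart-⊗ f g g-odd n)))

·-evenPart : ∀ c {G f} → G ≈ evenPart f → c · G ≈ evenPart (constant c ⊗ f)
·-evenPart c {G} {f} G≈ n = sym (begin
  (constant c ⊗ f) (n Nat.+ n) ≡⟨ ⊗-congʳ f (constant≈scalar c) (n Nat.+ n) ⟩
  (scalar c ⊗ f) (n Nat.+ n)   ≡⟨ scalar-⊗ c f (n Nat.+ n) ⟩
  c *ℤ f (n Nat.+ n)           ≡⟨ cong (c *ℤ_) (G≈ n) ⟨
  c *ℤ G n                     ∎)
  where open ≡-Reasoning

z^-evenPart : ∀ k {G f} → G ≈ evenPart f → z^ k · G ≈ evenPart (z^ k ⊗ f)
z^-evenPart zero    {G} G≈ n with n Nat.<? 0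
... | no _ = G≈ n
z^-evenPart (suc k) {G} {f} G≈ = begin
  z^ suc k · G                        ≈⟨ z^-suc k G ⟩
  shift (z^ k · G)                    ≈⟨ shift-cong (z^-evenPart k G≈) ⟩
  shift (evenPart (z^ k ⊗ f))         ≈⟨ evenPart-shift² (z^ k ⊗ f) ⟩
  evenPart (shift (shift (z^ k ⊗ f))) ≈⟨ evenPart-cong (shift²≈z⊗ (z^ k ⊗ f)) ⟩
  evenPart (z^ suc k ⊗ f)             ∎
  where
  open ≈-Reasoning
  z^-suc : ∀ k G → z^ suc k · G ≈ shift (z^ k · G)
  z^-suc k G zero    = refl
  z^-suc k G (suc n) with n Nat.<? k | suc n Nat.<? suc k
  ... | yes _   | yes _   = refl
  ... | no _    | no _    = refl
  ... | yes n<k | no n≮k  = ⊥-elim (n≮k (s≤s n<k))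
  ... | no n≮k  | yes n<k = ⊥-elim (n≮k (ℕₚ.≤-pred n<k))

  evenPart-shift² : ∀ f → shift (evenPart f) ≈ evenPart (shift (shift f))
  evenPart-shift² f zero    = refl
  evenPart-shift² f (suc n) rewrite ℕₚ.+-suc n n = refl

  evenPart-cong : ∀ {f g} → f ≈ g → evenPart f ≈ evenPart g
  evenPart-cong f≈g n = f≈g (n Nat.+ n)

theorem1 : (w : ℕ) → 4 ≤ w → (n : ℕ) →
    F w n ≡
      (one
        ⊝ (z^ 1 · F w)
        ⊕ (+ 2 · (z^ 1 · (F w ⊛ F (w ∸ 1))))
        ⊕ (+ 2 · (z^ 2 · (F w ⊛ F (w ∸ 1) ⊛ F (w ∸ 2))))
        ⊝ ((z^ 3 · (F w ⊛ F (w ∸ 1) ⊛ F (w ∸ 2) ⊛ F (w ∸ 3)))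
           ⊕ (z^ 4 · (F w ⊛ F (w ∸ 1) ⊛ F (w ∸ 2) ⊛ F (w ∸ 3))))
        ⊕ (z^ 5 · (F w ⊛ F (w ∸ 1) ⊛ F (w ∸ 2) ⊛ F (w ∸ 3) ⊛ F (w ∸ 4)))) n
theorem1 w 4≤w n = begin
  F w n
    ≡⟨ F≈evenPart w n ⟩
  a₀₀ w (n Nat.+ n)
    ≡⟨ a₀₀-identity w 4≤w (n Nat.+ n) ⟩
  _
    ≡⟨ ⊕-cong (⊝-cong (⊕-cong (⊕-cong (⊝-cong one≈evenPart (z^-evenPart 1 (F≈evenPart w)))
                                      (·-evenPart (+ 2) (z^-evenPart 1 Π₂)))
                              (·-evenPart (+ 2) (z^-evenPart 2 Π₃)))
                      (⊕-cong (z^-evenPart 3 Π₄) (z^-evenPart 4 Π₄)))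
              (z^-evenPart 5 Π₅) n ⟨
  _
    ∎
  where
  open ≡-Reasoning
  A : ℕ → Series
  A k = a₀₀ (w ∸ k)

  Π₂ : F w ⊛ F (w ∸ 1) ≈ evenPart (A 0 ⊗ A 1)
  Π₂ = ⊛-evenPart (F≈evenPart w) (F≈evenPart (w ∸ 1)) (a₀₀-oddFree (w ∸ 1))
  Π₃ : F w ⊛ F (w ∸ 1) ⊛ F (w ∸ 2) ≈ evenPart (A 0 ⊗ A 1 ⊗ A 2)
  Π₃ = ⊛-evenPart Π₂ (F≈evenPart (w ∸ 2)) (a₀₀-oddFree (w ∸ 2))
  Π₄ : F w ⊛ F (w ∸ 1) ⊛ F (w ∸ 2) ⊛ F (w ∸ 3) ≈ evenPart (A 0 ⊗ A 1 ⊗ A 2 ⊗ A 3)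
  Π₄ = ⊛-evenPart Π₃ (F≈evenPart (w ∸ 3)) (a₀₀-oddFree (w ∸ 3))
  Π₅ : F w ⊛ F (w ∸ 1) ⊛ F (w ∸ 2) ⊛ F (w ∸ 3) ⊛ F (w ∸ 4) ≈ evenPart (A 0 ⊗ A 1 ⊗ A 2 ⊗ A 3 ⊗ A 4)
  Π₅ = ⊛-evenPart Π₄ (F≈evenPart (w ∸ 4)) (a₀₀-oddFree (w ∸ 4))
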